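{- Let $\theta=(\sqrt5-1)/2$ and $\gamma(m)=\{m\theta\}$ (fractional part). Let $n\ge2$. Then for all integers $i,j$ with $0\le i\le L_{2n+1}-2$ and $0\le j\le F_{2n}-1$, $$\gamma(F_{4n}i+L_{2n}j+F_{2n-1})=(\gamma(F_{4n})-1)i+\gamma(L_{2n})j+\gamma(F_{2n-1}),$$ $$\gamma(F_{4n}i+L_{2n}j+L_{2n})=(\gamma(F_{4n})-1)i+\gamma(L_{2n})j+\gamma(L_{2n}).$$
   Context: Fibonacci numbers: $F_0=0$, $F_1=1$, $F_n=F_{n-1}+F_{n-2}$. Lucas numbers: $L_0=2$, $L_1=1$, $L_n=L_{n-1}+L_{n-2}$. -}

module Defs where

open import Data.Nat as ℕ using (ℕ; zero; suc; _≤?_)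
open import Data.Integer as ℤ using (ℤ; +_)
open import Relation.Nullary.Decidable using (yes; no)

F : ℕ → ℕ
F 0 = 0
F 1 = 1
F (suc (suc n)) = F (suc n) ℕ.+ F n

L : ℕ → ℕ
L 0 = 2
L 1 = 1
L (suc (suc n)) = L (suc n) ℕ.+ L n

-- θ = (√5 - 1)/2 is the positive root of x² + x - 1 = 0 and is irrational.
-- Real numbers of the form a + bθ (a, b ∈ ℤ): since θ is irrational, such a
-- number is determined by the pair (a , b), so equality of these reals is
-- exactly equality of the pairs.
record ℤ[θ] : Set where
  constructor _+_θ
  field
    re : ℤ
    th : ℤ

open ℤ[θ] public

infixl 6 _⊕_ _⊖_
infixl 7 _⊙_

_⊕_ : ℤ[θ] → ℤ[θ] → ℤ[θ]
(a + b θ) ⊕ (c + d θ) = (a ℤ.+ c) + (b ℤ.+ d) θ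

_⊖_ : ℤ[θ] → ℤ[θ] → ℤ[θ]
(a + b θ) ⊖ (c + d θ) = (a ℤ.- c) + (b ℤ.- d) θ

_⊙_ : ℤ → ℤ[θ] → ℤ[θ]
k ⊙ (a + b θ) = (k ℤ.* a) + (k ℤ.* b) θ

one : ℤ[θ]
one = (+ 1) + (+ 0) θ

-- For k, m ≥ 0:  k ≤ mθ  ⇔  k² + k m ≤ m²  (θ is the positive root of x²+x-1),
-- and ⌊mθ⌋ ≤ m since θ < 1. We search k = m, m-1, ..., 0 for the first such k.
floorθ : ℕ → ℕ
floorθ m = go m
  where
  go : ℕ → ℕ
  go zero = zero
  go (suc k) with (suc k ℕ.* suc k ℕ.+ suc k ℕ.* m) ≤? (m ℕ.* m)
  ... | yes _ = suc k
  ... | no  _ = go k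

γ : ℕ → ℤ[θ]
γ m = (ℤ.- (+ floorθ m)) + (+ m) θ

{-# OPTIONS --safe #-}
module Submission where

-- Since γ m = mθ − ⌊mθ⌋, both identities say that ⌊mθ⌋ = (⌊F₄ₙθ⌋ + 1) i + ⌊L₂ₙθ⌋ j + ⌊Cθ⌋
-- for m = F₄ₙ i + L₂ₙ j + C with C = F₂ₙ₋₁ or L₂ₙ. By Cassini, θ lies strictly between the
-- convergents F₆ₙ/F₆ₙ₊₁ and F₆ₙ₊₁/F₆ₙ₊₂, so ⌊mθ⌋ = k as soon as k/m ≤ F₆ₙ/F₆ₙ₊₁ and
-- F₆ₙ₊₁/F₆ₙ₊₂ ≤ (k+1)/m. D'Ocagne's identity gives the distance of the pairs (k, m) =
-- (F₄ₙ₋₁, F₄ₙ), (L₂ₙ₋₁, L₂ₙ), (F₂ₙ₋₂, F₂ₙ₋₁) to these bounds as explicit Fibonacci slacks,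
-- and the ranges of i and j are exactly those for which the accumulated slack of the
-- combination stays on the right side of both bounds.

open import Defs
open import Data.Nat using (ℕ; _+_; _*_; _∸_; _≤_)
open import Data.Integer using (+_)
open import Data.Product using (_×_)
open import Relation.Binary.PropositionalEquality using (_≡_)
open import Data.Nat using (zero; suc; pred; _<_; z≤n; s≤s; NonZero; >-nonZero)
open import Data.Nat.Properties
open import Data.Nat.Tactic.RingSolver using (solve-∀)
import Data.Integer as ℤ
open import Data.Integer.Properties using (pos-+; pos-*)
import Data.Integer.Tactic.RingSolver as ℤ-Solver
open import Data.Product using (_,_)
open import Data.Sum using (inj₁; inj₂)
open import Data.Empty using (⊥-elim)
open import Relation.Nullary using (yes; no)
open import Relation.Binary.PropositionalEquality

data Even : ℕ → Set
data Odd : ℕ → Set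

data Even where
  zero : Even 0
  suc  : ∀ {n} → Odd n → Even (suc n)

data Odd where
  suc : ∀ {n} → Even n → Odd (suc n)

even-+ : ∀ {m n} → Even m → Even n → Even (m + n)
odd-+ : ∀ {m n} → Odd m → Even n → Odd (m + n)
even-+ zero     en = en
even-+ (suc om) en = suc (odd-+ om en)
odd-+ (suc em) en = suc (even-+ em en)

even-double : ∀ n → Even (n + n)
even-double zero    = zero
even-double (suc n) = suc (subst Odd (sym (+-suc n n)) (suc (even-double n)))

-- d'Ocagne's identity F (s+1) F t − F s F (t+1) = (−1)^s F (t−s), split by parity to stay in ℕ.
F-dOcagne-even : ∀ {s t} r → Even s → s + r ≡ t → F (suc s) * F t ≡ F s * F (suc t) + F r
F-dOcagne-odd : ∀ {s t} r → Odd s → s + r ≡ t → F s * F (suc t) ≡ F (suc s) * F t + F r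
F-dOcagne-even r zero refl = +-identityʳ (F r)
F-dOcagne-even {suc s} r (suc odd) refl = begin
  (p + q) * y            ≡⟨ *-distribʳ-+ y p q ⟩
  p * y + q * y          ≡⟨ cong (λ w → p * y + w) (F-dOcagne-odd r odd refl) ⟩
  p * y + (p * z + F r)  ≡⟨ +-assoc (p * y) (p * z) (F r) ⟨
  p * y + p * z + F r    ≡⟨ cong (_+ F r) (*-distribˡ-+ p y z) ⟨
  p * (y + z) + F r      ∎
  where
  open ≡-Reasoning
  p = F (suc s); q = F s; y = F (suc (s + r)); z = F (s + r)
F-dOcagne-odd {suc s} r (suc even) refl = begin
  p * (y + z)            ≡⟨ *-distribˡ-+ p y z ⟩
  p * y + p * z          ≡⟨ cong (λ w → p * y + w) (F-dOcagne-even r even refl) ⟩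
  p * y + (q * y + F r)  ≡⟨ +-assoc (p * y) (q * y) (F r) ⟨
  p * y + q * y + F r    ≡⟨ cong (_+ F r) (*-distribʳ-+ y p q) ⟨
  (p + q) * y + F r      ∎
  where
  open ≡-Reasoning
  p = F (suc s); q = F s; y = F (suc (s + r)); z = F (s + r)

F-add : ∀ a b {t} → a + b ≡ t → F (suc t) ≡ F (suc a) * F (suc b) + F a * F b
F-add zero    b refl = sym (trans (+-identityʳ _) (+-identityʳ _))
F-add (suc a) b {t} eq = begin
  F (suc t)                                        ≡⟨ F-add a (suc b) (trans (+-suc a b) eq) ⟩
  F (suc a) * (F (suc b) + F b) + F a * F (suc b)  ≡⟨ regroup (F (suc a)) (F a) (F (suc b)) (F b) ⟩
  (F (suc a) + F a) * F (suc b) + F (suc a) * F b  ∎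
  where
  open ≡-Reasoning
  regroup : ∀ p q y z → p * (y + z) + q * y ≡ (p + q) * y + p * z
  regroup = solve-∀

L-suc : ∀ n → L (suc n) ≡ F n + F (suc (suc n))
L-suc zero          = refl
L-suc (suc zero)    = refl
L-suc (suc (suc n)) = begin
  L (suc (suc n)) + L (suc n)                  ≡⟨ cong₂ _+_ (L-suc (suc n)) (L-suc n) ⟩
  (F (suc n) + F (3 + n)) + (F n + F (2 + n))  ≡⟨ regroup (F (suc n)) (F n) (F (3 + n)) ⟩
  F (2 + n) + F (4 + n)                        ∎
  where
  open ≡-Reasoning
  regroup : ∀ p q w → (p + w) + (q + (p + q)) ≡ (p + q) + (w + (p + q))
  regroup = solve-∀

L*F≡F-double : ∀ n → L n * F n ≡ F (n + n)
L*F≡F-double zero    = refl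
L*F≡F-double (suc m) = begin
  L (suc m) * F (suc m)                    ≡⟨ cong (_* F (suc m)) (L-suc m) ⟩
  (F m + F (2 + m)) * F (suc m)            ≡⟨ regroup (F m) (F (2 + m)) (F (suc m)) ⟩
  F (2 + m) * F (suc m) + F (suc m) * F m  ≡⟨ F-add (suc m) m (sym (+-suc m m)) ⟨
  F (suc (m + suc m))                      ∎
  where
  open ≡-Reasoning
  regroup : ∀ p r q → (p + r) * q ≡ r * q + q * p
  regroup = solve-∀

F-pos : ∀ n → 0 < F (suc n)
F-pos zero    = s≤s z≤n
F-pos (suc n) = ≤-trans (F-pos n) (m≤m+n _ _)

F-≤-suc : ∀ n → F n ≤ F (suc n)
F-≤-suc zero    = z≤n
F-≤-suc (suc n) = m≤m+n _ _

F-mono : ∀ k n → F n ≤ F (k + n)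
F-mono zero    n = ≤-refl
F-mono (suc k) n = ≤-trans (F-mono k n) (F-≤-suc (k + n))

-- k ≤ m ·θ and k > m ·θ are k ≤ mθ and k > mθ, read through θ² + θ = 1 as in floorθ.
infix 4 _≤_·θ _>_·θ

_≤_·θ : ℕ → ℕ → Set
k ≤ m ·θ = k * k + k * m ≤ m * m

_>_·θ : ℕ → ℕ → Set
k > m ·θ = m * m < k * k + k * m

≤·θ-antitone : ∀ {k k′ m} → k ≤ k′ → k′ ≤ m ·θ → k ≤ m ·θ
≤·θ-antitone {m = m} k≤k′ = ≤-trans (+-mono-≤ (*-mono-≤ k≤k′ k≤k′) (*-monoˡ-≤ m k≤k′))

-- The search loop of floorθ is local to Defs; the meta floorθ-search is solved by
-- unification against it in the with-clause below, which makes it nameable.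
mutual
  floorθ-search : ℕ → ℕ → ℕ
  floorθ-search = _

  private
    floorθ-unfolds : ∀ s → floorθ (suc s) ≡ floorθ (suc s)
    floorθ-unfolds s with suc s * suc s + suc s * suc s ≤? suc s * suc s
    ... | yes _ = refl
    ... | no _ with suc s
    ...   | m = refl {x = floorθ-search m s}

floorθ-search-unique : ∀ {m k} s → k ≤ s → k ≤ m ·θ → suc k > m ·θ → floorθ-search m s ≡ k
floorθ-search-unique zero z≤n _ _ = refl
floorθ-search-unique {m} {k} (suc s) k≤1+s below above
  with suc s * suc s + suc s * m ≤? m * m | m≤n⇒m<n∨m≡n k≤1+s
... | yes 1+s≤mθ | inj₁ k<1+s = ⊥-elim (<⇒≱ above (≤·θ-antitone {m = m} k<1+s 1+s≤mθ))
... | yes _      | inj₂ k≡1+s = sym k≡1+s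
... | no _       | inj₁ k<1+s = floorθ-search-unique s (≤-pred k<1+s) below above
... | no 1+s≰mθ  | inj₂ refl  = ⊥-elim (1+s≰mθ below)

floorθ-unique : ∀ {m k} → k ≤ m → k ≤ m ·θ → suc k > m ·θ → floorθ m ≡ k
floorθ-unique {m} = floorθ-search-unique m

·θ-scale : ∀ k m c → (k * k + k * m) * (c * c) ≡ (k * c) * (k * c + m * c)
·θ-scale = solve-∀

·θ-factor : ∀ c k m → (c * k) * (c * k + c * m) ≡ (c * c) * (k * k + k * m)
·θ-factor = solve-∀

≤·θ-by-ratio : ∀ {X Y k m} → .{{NonZero Y}} → X ≤ Y ·θ → k * Y ≤ m * X → k ≤ m ·θ
≤·θ-by-ratio {X} {Y} {k} {m} X≤Yθ kY≤mX = *-cancelʳ-≤ _ _ (Y * Y) {{m*n≢0 Y Y}} (begin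
  (k * k + k * m) * (Y * Y)  ≡⟨ ·θ-scale k m Y ⟩
  (k * Y) * (k * Y + m * Y)  ≤⟨ *-mono-≤ kY≤mX (+-monoˡ-≤ (m * Y) kY≤mX) ⟩
  (m * X) * (m * X + m * Y)  ≡⟨ ·θ-factor m X Y ⟩
  (m * m) * (X * X + X * Y)  ≤⟨ *-monoʳ-≤ (m * m) X≤Yθ ⟩
  (m * m) * (Y * Y)          ∎)
  where open ≤-Reasoning

>·θ-by-ratio : ∀ {Y Z K m} → .{{NonZero m}} → Y > Z ·θ → m * Y ≤ K * Z → K > m ·θ
>·θ-by-ratio {Y} {Z} {K} {m} Y>Zθ mY≤KZ = *-cancelʳ-< (Z * Z) (m * m) (K * K + K * m) (begin-strict
  (m * m) * (Z * Z)          <⟨ *-monoʳ-< (m * m) {{m*n≢0 m m}} Y>Zθ ⟩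
  (m * m) * (Y * Y + Y * Z)  ≡⟨ ·θ-factor m Y Z ⟨
  (m * Y) * (m * Y + m * Z)  ≤⟨ *-mono-≤ mY≤KZ (+-monoˡ-≤ (m * Z) mY≤KZ) ⟩
  (K * Z) * (K * Z + m * Z)  ≡⟨ ·θ-scale K m Z ⟨
  (K * K + K * m) * (Z * Z)  ∎)
  where open ≤-Reasoning

F-below-θ : ∀ {N} → Even N → F N ≤ F (1 + N) ·θ
F-below-θ {N} even = begin
  F N * F N + F N * F (1 + N)  ≡⟨ +-comm (F N * F N) _ ⟩
  F N * F (1 + N) + F N * F N  ≡⟨ *-distribˡ-+ (F N) (F (1 + N)) (F N) ⟨
  F N * F (2 + N)              ≤⟨ m≤m+n _ 1 ⟩
  F N * F (2 + N) + 1          ≡⟨ F-dOcagne-even 1 even (+-comm N 1) ⟨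
  F (1 + N) * F (1 + N)        ∎
  where open ≤-Reasoning

F-above-θ : ∀ {N} → Even N → F (1 + N) > F (2 + N) ·θ
F-above-θ {N} even = begin-strict
  F (2 + N) * F (2 + N)                          <⟨ m<m+n _ (s≤s z≤n) ⟩
  F (2 + N) * F (2 + N) + 1                      ≡⟨ F-dOcagne-odd 1 (suc even) (+-comm (1 + N) 1) ⟨
  F (1 + N) * (F (2 + N) + F (1 + N))            ≡⟨ *-distribˡ-+ (F (1 + N)) _ _ ⟩
  F (1 + N) * F (2 + N) + F (1 + N) * F (1 + N)  ≡⟨ +-comm (F (1 + N) * F (2 + N)) _ ⟩
  F (1 + N) * F (1 + N) + F (1 + N) * F (2 + N)  ∎
  where open ≤-Reasoning

floorθ-between-convergents : ∀ {N m k} → Even N → .{{NonZero m}} →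
  k * F (1 + N) ≤ m * F N → m * F (1 + N) ≤ suc k * F (2 + N) → floorθ m ≡ k
floorθ-between-convergents {N} {m} {k} even lower upper = floorθ-unique k≤m
  (≤·θ-by-ratio {F N} {F (1 + N)} {k} {m} {{F≢0}} (F-below-θ even) lower)
  (>·θ-by-ratio {F (1 + N)} {F (2 + N)} {suc k} {m} (F-above-θ even) upper)
  where
  F≢0 : NonZero (F (1 + N))
  F≢0 = >-nonZero (F-pos N)
  k≤m : k ≤ m
  k≤m = *-cancelʳ-≤ k m (F (1 + N)) {{F≢0}} (≤-trans lower (*-monoʳ-≤ m (F-≤-suc N)))

linear-slack-jc : ∀ a b c X i j W R →
  (a * i + b * j + c) * X + (j * W + R) ≡ i * (a * X) + j * (b * X + W) + (c * X + R)
linear-slack-jc = solve-∀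

linear-slack-i : ∀ a b c X i j U →
  (a * i + b * j + c) * X + i * U ≡ i * (a * X + U) + j * (b * X) + c * X
linear-slack-i = solve-∀

cong-linear : ∀ i j {p p′ q q′ r r′} → p ≡ p′ → q ≡ q′ → r ≡ r′ →
  i * p + j * q + r ≡ i * p′ + j * q′ + r′
cong-linear i j refl refl refl = refl

linear-at-zero : ∀ a b c → a * 0 + b * 0 + c ≡ c
linear-at-zero = solve-∀

combination-below : ∀ {X Y A a B b C c U W R} i j →
  a * Y ≡ A * X + U → B * X ≡ b * Y + W → C * X ≡ c * Y + R → i * U ≤ j * W + R →
  (a * i + b * j + c) * Y ≤ (A * i + B * j + C) * X
combination-below {X} {Y} {A} {a} {B} {b} {C} {c} {U} {W} {R} i j aY BX CX iU≤jW+R =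
  +-cancelʳ-≤ (j * W + R) _ _ (begin
    (a * i + b * j + c) * Y + (j * W + R)        ≡⟨ linear-slack-jc a b c Y i j W R ⟩
    i * (a * Y) + j * (b * Y + W) + (c * Y + R)  ≡⟨ cong-linear i j aY (sym BX) (sym CX) ⟩
    i * (A * X + U) + j * (B * X) + C * X        ≡⟨ linear-slack-i A B C X i j U ⟨
    (A * i + B * j + C) * X + i * U              ≤⟨ +-monoʳ-≤ _ iU≤jW+R ⟩
    (A * i + B * j + C) * X + (j * W + R)        ∎)
  where open ≤-Reasoning

combination-above : ∀ {Y Z A a B b C c P V S} i j →
  a * Z ≡ A * Y + P → B * Y ≡ b * Z + V → C * Y ≡ c * Z + S → j * V + S ≤ Z →
  (A * i + B * j + C) * Y ≤ suc (a * i + b * j + c) * Z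
combination-above {Y} {Z} {A} {a} {B} {b} {C} {c} {P} {V} {S} i j aZ BY CY jV+S≤Z = begin
  (A * i + B * j + C) * Y                      ≤⟨ m≤m+n _ (i * P) ⟩
  (A * i + B * j + C) * Y + i * P              ≡⟨ linear-slack-i A B C Y i j P ⟩
  i * (A * Y + P) + j * (B * Y) + C * Y        ≡⟨ cong-linear i j (sym aZ) BY CY ⟩
  i * (a * Z) + j * (b * Z + V) + (c * Z + S)  ≡⟨ linear-slack-jc a b c Z i j V S ⟨
  (a * i + b * j + c) * Z + (j * V + S)        ≤⟨ +-monoʳ-≤ _ jV+S≤Z ⟩
  (a * i + b * j + c) * Z + Z                  ≡⟨ +-comm _ Z ⟩
  suc (a * i + b * j + c) * Z                  ∎
  where open ≤-Reasoning

sum-of-rows : ∀ {P p Q q X Y r s} → P * X ≡ p * Y + r → Q * X ≡ q * Y + s →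
  (P + Q) * X ≡ (p + q) * Y + (r + s)
sum-of-rows {P} {p} {Q} {q} {X} {Y} {r} {s} PX QX = begin
  (P + Q) * X                ≡⟨ *-distribʳ-+ X P Q ⟩
  P * X + Q * X              ≡⟨ cong₂ _+_ PX QX ⟩
  (p * Y + r) + (q * Y + s)  ≡⟨ regroup p q Y r s ⟩
  (p + q) * Y + (r + s)      ∎
  where
  open ≡-Reasoning
  regroup : ∀ p q Y r s → (p * Y + r) + (q * Y + s) ≡ (p + q) * Y + (r + s)
  regroup = solve-∀

pos-linear : ∀ a i b j c → + (a * i + b * j + c) ≡ + a ℤ.* + i ℤ.+ + b ℤ.* + j ℤ.+ + c
pos-linear a i b j c = begin
  + (a * i + b * j + c)                ≡⟨ pos-+ (a * i + b * j) c ⟩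
  + (a * i + b * j) ℤ.+ + c            ≡⟨ cong (ℤ._+ + c) (pos-+ (a * i) (b * j)) ⟩
  + (a * i) ℤ.+ + (b * j) ℤ.+ + c      ≡⟨ cong₂ (λ x y → x ℤ.+ y ℤ.+ + c) (pos-* a i) (pos-* b j) ⟩
  + a ℤ.* + i ℤ.+ + b ℤ.* + j ℤ.+ + c  ∎
  where open ≡-Reasoning

γ-linear : ∀ A B C i j →
  floorθ (A * i + B * j + C) ≡ suc (floorθ A) * i + floorθ B * j + floorθ C →
  γ (A * i + B * j + C) ≡ (+ i) ⊙ (γ A ⊖ one) ⊕ (+ j) ⊙ γ B ⊕ γ C
γ-linear A B C i j floorθ-affine = cong₂ _+_θ
  (trans (cong (λ k → ℤ.- (+ k)) floorθ-affine)
    (trans (cong ℤ.-_ (pos-linear (suc (floorθ A)) i (floorθ B) j (floorθ C)))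
      (integral-part (+ i) (+ j) (+ floorθ A) (+ floorθ B) (+ floorθ C))))
  (trans (pos-linear A i B j C) (θ-part (+ i) (+ j) (+ A) (+ B) (+ C)))
  where
  integral-part : ∀ i j a b c → ℤ.- ((ℤ.1ℤ ℤ.+ a) ℤ.* i ℤ.+ b ℤ.* j ℤ.+ c)
                  ≡ i ℤ.* (ℤ.- a ℤ.- ℤ.1ℤ) ℤ.+ j ℤ.* ℤ.- b ℤ.+ ℤ.- c
  integral-part = ℤ-Solver.solve-∀
  θ-part : ∀ i j a b c → a ℤ.* i ℤ.+ b ℤ.* j ℤ.+ c ≡ i ℤ.* (a ℤ.- ℤ.0ℤ) ℤ.+ j ℤ.* b ℤ.+ c
  θ-part = ℤ-Solver.solve-∀

-- d = 2n − 2, so that N = 6n and A = F₄ₙ, a = F₄ₙ₋₁, B = L₂ₙ, b = L₂ₙ₋₁, C = F₂ₙ₋₁, c = F₂ₙ₋₂.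
module Shifted (d : ℕ) (even-d : Even d) where

  N : ℕ
  N = 6 + 3 * d

  A a B b C c : ℕ
  A = F (4 + 2 * d)
  a = F (3 + 2 * d)
  B = L (2 + d)
  b = L (1 + d)
  C = F (1 + d)
  c = F d

  even-2d : Even (2 * d)
  even-2d = even-+ even-d (even-+ even-d zero)

  even-N : Even N
  even-N = suc (suc (suc (suc (suc (suc (even-+ even-d even-2d))))))

  A-row : ∀ h → a * F (suc h + N) ≡ A * F (h + N) + F (h + (3 + d))
  A-row h = F-dOcagne-odd (h + (3 + d)) (suc (suc (suc even-2d))) (index d h)
    where
    index : ∀ d h → 3 + 2 * d + (h + (3 + d)) ≡ h + (6 + 3 * d)
    index = solve-∀

  C-row : ∀ h → C * F (h + N) ≡ c * F (suc h + N) + F (h + (6 + 2 * d))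
  C-row h = F-dOcagne-even (h + (6 + 2 * d)) even-d (index d h)
    where
    index : ∀ d h → d + (h + (6 + 2 * d)) ≡ h + (6 + 3 * d)
    index = solve-∀

  D-row : ∀ h → F (3 + d) * F (h + N) ≡ F (2 + d) * F (suc h + N) + F (h + (4 + 2 * d))
  D-row h = F-dOcagne-even (h + (4 + 2 * d)) (suc (suc even-d)) (index d h)
    where
    index : ∀ d h → 2 + d + (h + (4 + 2 * d)) ≡ h + (6 + 3 * d)
    index = solve-∀

  B-row : ∀ h → B * F (h + N) ≡ b * F (suc h + N) + (F (h + (6 + 2 * d)) + F (h + (4 + 2 * d)))
  B-row h = begin
    B * F (h + N)                        ≡⟨ cong (_* F (h + N)) (L-suc (1 + d)) ⟩
    (C + F (3 + d)) * F (h + N)          ≡⟨ sum-of-rows {C} {c} {F (3 + d)} {F (2 + d)} (C-row h) (D-row h) ⟩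
    (c + F (2 + d)) * F (suc h + N) + W  ≡⟨ cong (λ p → p * F (suc h + N) + W) (L-suc d) ⟨
    b * F (suc h + N) + W                ∎
    where
    open ≡-Reasoning
    W = F (h + (6 + 2 * d)) + F (h + (4 + 2 * d))

  i-bound : ∀ {i} → i ≤ L (3 + d) ∸ 2 → i * F (3 + d) ≤ F (6 + 2 * d)
  i-bound {i} hi = begin
    i * F (3 + d)          ≤⟨ *-monoˡ-≤ (F (3 + d)) (≤-trans hi (m∸n≤m (L (3 + d)) 2)) ⟩
    L (3 + d) * F (3 + d)  ≡⟨ L*F≡F-double (3 + d) ⟩
    F (3 + d + (3 + d))    ≡⟨ cong F (index d) ⟩
    F (6 + 2 * d)          ∎
    where
    open ≤-Reasoning
    index : ∀ d → 3 + d + (3 + d) ≡ 6 + 2 * d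
    index = solve-∀

  V : ℕ
  V = F (7 + 2 * d) + F (5 + 2 * d)

  j-bound : ∀ {j} → j ≤ F (2 + d) ∸ 1 → suc j * V ≤ F (2 + N)
  j-bound {j} hj = begin
    suc j * V
      ≤⟨ *-monoˡ-≤ V 1+j≤F ⟩
    F (2 + d) * V
      ≡⟨ *-distribˡ-+ (F (2 + d)) _ _ ⟩
    F (2 + d) * F (7 + 2 * d) + F (2 + d) * F (5 + 2 * d)
      ≤⟨ +-monoˡ-≤ (F (2 + d) * F (5 + 2 * d)) (m≤m+n _ (F (4 + d))) ⟩
    F (2 + d) * F (7 + 2 * d) + F (4 + d) + F (2 + d) * F (5 + 2 * d)
      ≡⟨ cong (_+ F (2 + d) * F (5 + 2 * d)) (F-dOcagne-even (4 + d) (suc (suc even-d)) (index₁ d)) ⟨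
    F (3 + d) * F (6 + 2 * d) + F (2 + d) * F (5 + 2 * d)
      ≡⟨ F-add (2 + d) (5 + 2 * d) (index₂ d) ⟨
    F (2 + N)
      ∎
    where
    open ≤-Reasoning
    1+j≤F : suc j ≤ F (2 + d)
    1+j≤F = ≤-trans (s≤s hj) (≤-reflexive (trans (+-comm 1 _) (m∸n+n≡m (F-pos (suc d)))))
    index₁ : ∀ d → 2 + d + (4 + d) ≡ 6 + 2 * d
    index₁ = solve-∀
    index₂ : ∀ d → 2 + d + (5 + 2 * d) ≡ 7 + 3 * d
    index₂ = solve-∀

  floorθ-combination : ∀ {C′ c′ R S} i j → i ≤ L (3 + d) ∸ 2 → j ≤ F (2 + d) ∸ 1 → 0 < C′ →
    C′ * F N ≡ c′ * F (1 + N) + R → C′ * F (1 + N) ≡ c′ * F (2 + N) + S →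
    F (6 + 2 * d) ≤ R → S ≤ V → floorθ (A * i + B * j + C′) ≡ a * i + b * j + c′
  floorθ-combination {C′} {c′} {R} {S} i j hi hj C′>0 row₀ row₁ F≤R S≤V =
    floorθ-between-convergents even-N {{>-nonZero (≤-trans C′>0 (m≤n+m C′ (A * i + B * j)))}}
      (combination-below {F N} {F (1 + N)} {A} {a} {B} {b} {C′} {c′} i j (A-row 0) (B-row 0) row₀
        (≤-trans (i-bound hi) (≤-trans F≤R (m≤n+m R _))))
      (combination-above {F (1 + N)} {F (2 + N)} {A} {a} {B} {b} {C′} {c′} i j (A-row 1) (B-row 1) row₁
        (≤-trans (+-monoʳ-≤ (j * V) S≤V) (≤-trans (≤-reflexive (+-comm (j * V) V)) (j-bound hj))))

  suc-floorθ-A : suc (floorθ A) ≡ a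
  suc-floorθ-A = trans (cong suc floorθ-A) (suc-pred a {{a≢0}})
    where
    a≢0 : NonZero a
    a≢0 = >-nonZero (F-pos (2 + 2 * d))
    floorθ-A : floorθ A ≡ pred a
    floorθ-A = floorθ-between-convergents even-N {{>-nonZero (F-pos (3 + 2 * d))}} lower upper
      where
      open ≤-Reasoning
      lower : pred a * F (1 + N) ≤ A * F N
      lower = +-cancelʳ-≤ (F (1 + N)) _ _ (begin
        pred a * F (1 + N) + F (1 + N)     ≡⟨ +-comm _ (F (1 + N)) ⟩
        suc (pred a) * F (1 + N)           ≡⟨ cong (_* F (1 + N)) (suc-pred a {{a≢0}}) ⟩
        a * F (1 + N)                      ≡⟨ A-row 0 ⟩
        A * F N + F (3 + d)                ≤⟨ +-monoʳ-≤ (A * F N) (F-mono (4 + 2 * d) (3 + d)) ⟩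
        A * F N + F (4 + 2 * d + (3 + d))  ≡⟨ cong (λ k → A * F N + F k) (index d) ⟩
        A * F N + F (1 + N)                ∎)
        where
        index : ∀ d → 4 + 2 * d + (3 + d) ≡ 7 + 3 * d
        index = solve-∀
      upper : A * F (1 + N) ≤ suc (pred a) * F (2 + N)
      upper = begin
        A * F (1 + N)              ≤⟨ m≤m+n _ (F (4 + d)) ⟩
        A * F (1 + N) + F (4 + d)  ≡⟨ A-row 1 ⟨
        a * F (2 + N)              ≡⟨ cong (_* F (2 + N)) (suc-pred a {{a≢0}}) ⟨
        suc (pred a) * F (2 + N)   ∎

  floorθ-C-combination : ∀ i j → i ≤ L (3 + d) ∸ 2 → j ≤ F (2 + d) ∸ 1 →
    floorθ (A * i + B * j + C) ≡ a * i + b * j + c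
  floorθ-C-combination i j hi hj =
    floorθ-combination i j hi hj (F-pos d) (C-row 0) (C-row 1) ≤-refl (m≤m+n _ _)

  floorθ-B-combination : ∀ i j → i ≤ L (3 + d) ∸ 2 → j ≤ F (2 + d) ∸ 1 →
    floorθ (A * i + B * j + B) ≡ a * i + b * j + b
  floorθ-B-combination i j hi hj =
    floorθ-combination i j hi hj B>0 (B-row 0) (B-row 1) (m≤m+n _ _) ≤-refl
    where
    B>0 : 0 < B
    B>0 = ≤-trans (F-pos d) (≤-trans (m≤m+n _ _) (≤-reflexive (sym (L-suc (1 + d)))))

  floorθ-B : floorθ B ≡ b
  floorθ-B = begin
    floorθ B                    ≡⟨ cong floorθ (linear-at-zero A B B) ⟨
    floorθ (A * 0 + B * 0 + B)  ≡⟨ floorθ-B-combination 0 0 z≤n z≤n ⟩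
    a * 0 + b * 0 + b           ≡⟨ linear-at-zero a b b ⟩
    b                           ∎
    where open ≡-Reasoning

  floorθ-C : floorθ C ≡ c
  floorθ-C = begin
    floorθ C                    ≡⟨ cong floorθ (linear-at-zero A B C) ⟨
    floorθ (A * 0 + B * 0 + C)  ≡⟨ floorθ-C-combination 0 0 z≤n z≤n ⟩
    a * 0 + b * 0 + c           ≡⟨ linear-at-zero a b c ⟩
    c                           ∎
    where open ≡-Reasoning

  floorθ-linear : ∀ {C′ c′} i j → floorθ C′ ≡ c′ → floorθ (A * i + B * j + C′) ≡ a * i + b * j + c′ →
    floorθ (A * i + B * j + C′) ≡ suc (floorθ A) * i + floorθ B * j + floorθ C′
  floorθ-linear {C′} i j refl floorθ≡ =
    trans floorθ≡ (cong₂ (λ x y → x * i + y * j + floorθ C′) (sym suc-floorθ-A) (sym floorθ-B))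

  γ-identities : ∀ {p₁ p₂ p₃ p₄} → p₁ ≡ 3 + d → p₂ ≡ 2 + d → p₃ ≡ 1 + d → p₄ ≡ 4 + 2 * d →
    ∀ i j → i ≤ L p₁ ∸ 2 → j ≤ F p₂ ∸ 1 →
    (γ (F p₄ * i + L p₂ * j + F p₃) ≡ (+ i) ⊙ (γ (F p₄) ⊖ one) ⊕ (+ j) ⊙ γ (L p₂) ⊕ γ (F p₃))
    × (γ (F p₄ * i + L p₂ * j + L p₂) ≡ (+ i) ⊙ (γ (F p₄) ⊖ one) ⊕ (+ j) ⊙ γ (L p₂) ⊕ γ (L p₂))
  γ-identities refl refl refl refl i j hi hj =
    γ-linear A B C i j (floorθ-linear i j floorθ-C (floorθ-C-combination i j hi hj)) ,
    γ-linear A B B i j (floorθ-linear i j floorθ-B (floorθ-B-combination i j hi hj))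

lemma11 : (n : ℕ) → 2 ≤ n → (i j : ℕ) → i ≤ L (2 * n + 1) ∸ 2 → j ≤ F (2 * n) ∸ 1 →
    (γ (F (4 * n) * i + L (2 * n) * j + F (2 * n ∸ 1))
       ≡ (+ i) ⊙ (γ (F (4 * n)) ⊖ one) ⊕ (+ j) ⊙ γ (L (2 * n)) ⊕ γ (F (2 * n ∸ 1)))
    × (γ (F (4 * n) * i + L (2 * n) * j + L (2 * n))
       ≡ (+ i) ⊙ (γ (F (4 * n)) ⊖ one) ⊕ (+ j) ⊙ γ (L (2 * n)) ⊕ γ (L (2 * n)))
lemma11 (suc q) _ = Shifted.γ-identities (q + q) (even-double q)
  (index-2n+1 q) (index-2n q) (index-2n-1 q) (index-4n q)
  where
  index-2n+1 : ∀ q → 2 * suc q + 1 ≡ 3 + (q + q)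
  index-2n+1 = solve-∀
  index-2n : ∀ q → 2 * suc q ≡ 2 + (q + q)
  index-2n = solve-∀
  -- 2 * suc q ∸ 1 computes to q + suc (q + 0).
  index-2n-1 : ∀ q → q + suc (q + 0) ≡ 1 + (q + q)
  index-2n-1 = solve-∀
  index-4n : ∀ q → 4 * suc q ≡ 4 + 2 * (q + q)
  index-4n = solve-∀
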